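{- Let $G$ be a graph, and let $D$ denote the set of vertices of $G$ of degree $1$. Let $v\in V(G)$ be such that $N(v)\cap D=\{u\}$. Then $G$ has an IP-partition of minimum cardinality containing a path that has $u$ as an endpoint and has length at least $1$.
   Context: All graphs are finite, simple and undirected; $N(v)$ denotes the set of neighbours of $v$. A path is isometric if it is a shortest path in $G$ between its endpoints. An IP-partition of $G$ is a partition of $V(G)$ into vertex sets of isometric paths of $G$; its cardinality is the number of paths. The length of a path is its number of edges. -}

module Defs where

open import Data.Nat using (ℕ; zero; suc; _≤_)
open import Data.Bool using (Bool; true; false)
open import Data.Fin using (Fin)
open import Data.List using (List; []; _∷_; length; filterᵇ; allFin)
open import Data.List.NonEmpty using (List⁺; _∷_; head; last; toList)
open import Data.List.Relation.Unary.Linked using (Linked)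
open import Data.List.Relation.Unary.Unique.Propositional using (Unique)
open import Data.List.Membership.Propositional using (_∈_)
open import Data.Product using (Σ; ∃; _×_)
open import Relation.Binary.PropositionalEquality using (_≡_)

record Graph : Set where
  field
    n      : ℕ
    adj    : Fin n → Fin n → Bool
    sym    : ∀ x y → adj x y ≡ adj y x
    irrefl : ∀ x → adj x x ≡ false

module _ (G : Graph) where
  open Graph G

  Vertex : Set
  Vertex = Fin n

  Adj : Vertex → Vertex → Set
  Adj x y = adj x y ≡ true

  degree : Vertex → ℕ
  degree x = length (filterᵇ (adj x) (allFin n))

  data Walk : Vertex → Vertex → ℕ → Set where
    nil  : ∀ {a} → Walk a a 0
    cons : ∀ {a b c k} → Adj a b → Walk b c k → Walk a c (suc k)

  record Path : Set where
    field
      verts    : List⁺ Vertex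
      linked   : Linked Adj (toList verts)
      distinct : Unique (toList verts)

  open Path public

  -- length = number of edges
  pathLength : Path → ℕ
  pathLength (record { verts = _ ∷ xs }) = length xs

  start end : Path → Vertex
  start P = head (verts P)
  end P = last (verts P)

  IsIsometric : Path → Set
  IsIsometric P = ∀ k → Walk (start P) (end P) k → pathLength P ≤ k

  OnPath : Vertex → Path → Set
  OnPath x P = x ∈ toList (verts P)

  record IPPartition (k : ℕ) : Set where
    field
      path      : Fin k → Path
      isometric : ∀ i → IsIsometric (path i)
      covers    : ∀ x → ∃ λ i → OnPath x (path i)
      disjoint  : ∀ x i j → OnPath x (path i) → OnPath x (path j) → i ≡ j

  open IPPartition public

  IsMinimumIP : ℕ → Set
  IsMinimumIP k = ∀ k' → IPPartition k' → k ≤ k'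

{-# OPTIONS --safe #-}
module Submission where

-- As u has degree 1, if the path through u has an edge then u
-- is one of its endpoints. Otherwise {u} is a trivial path; let R be the path through v.
-- Cutting R right after v and appending u gives an isometric path X ending at u, because
-- every walk to u enters it from v; the rest Y of R is isometric as a subpath of R. If Y
-- is empty, X replaces {u} and R and the partition shrinks, contradicting minimality;
-- otherwise X and Y replace {u} and R in a partition of the same size.
-- Minimum IP-partitions exist constructively because "there is an IP-partition of size k"
-- is decidable, by exhaustive search over vertex lists of length at most n.

open import Defs
open import Level using (0ℓ)
open import Data.Nat using (ℕ; zero; suc; _≤_; _≰_; _+_; z≤n; s≤s)
open import Data.Nat.Properties using (_≤?_; 1+n≰n; m≤n+m; ≤-trans; n≤1+n; +-comm; +-cancelˡ-≤; +-cancelʳ-≤; ≮⇒≥; <⇒≱)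
open import Data.Fin using (Fin; zero; suc; toℕ; fromℕ<; punchIn; punchOut)
open import Data.Fin.Properties using (any?; all?; ¬Fin0; toℕ<n; toℕ-fromℕ<; injective⇒≤; punchIn-injective; punchInᵢ≢i; punchIn-punchOut) renaming (_≟_ to _≟ᶠ_)
open import Data.Bool using (T; true)
open import Data.Bool.Properties using () renaming (_≟_ to _≟ᵇ_)
open import Data.List using (List; []; _∷_; _++_; [_]; length; lookup; filterᵇ; allFin; initLast; _∷ʳ′_)
open import Data.List.Properties using (length-++; ++-assoc)
open import Data.List.NonEmpty using (tail; last) renaming (_∷_ to _∷⁺_)
open import Data.List.Relation.Unary.Linked as Linked using (Linked; []; [-]; _∷_; linked?)
open import Data.List.Relation.Unary.AllPairs using (AllPairs; []; _∷_; allPairs?)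
open import Data.List.Relation.Unary.All as All using ([]; _∷_)
import Data.List.Relation.Unary.All.Properties as Allₚ
open import Data.List.Relation.Unary.Any using (here; there)
open import Data.List.Relation.Unary.Unique.Propositional using (Unique)
import Data.List.Relation.Unary.Unique.Propositional.Properties as Unique
open import Data.List.Membership.Propositional using (_∈_; _∉_)
open import Data.List.Membership.Propositional.Properties using (∈-++⁺ˡ; ∈-++⁺ʳ; ∈-++⁻; ∈-∃++; ∈-lookup; ∈-allFin; ∈-filter⁺)
open import Data.Vec using (Vec; []; _∷_; tabulate) renaming (lookup to lookupᵛ)
open import Data.Vec.Properties using (lookup∘tabulate)
open import Data.Product using (Σ; ∃; ∃₂; _×_; _,_; proj₁; proj₂)
open import Data.Sum using (_⊎_; inj₁; inj₂; map₁; map₂)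
open import Data.Sum.Function.Propositional using (_⊎-⇔_)
open import Function using (_∘_; _⇔_; Equivalence; mk⇔)
open import Function.Properties.Equivalence using () renaming (refl to ⇔-refl; sym to ⇔-sym; trans to ⇔-trans)
open import Relation.Unary using (Pred; Decidable)
open import Relation.Binary using (Rel)
open import Relation.Nullary using (Dec; yes; no; ¬_; contradiction)
open import Relation.Nullary.Decidable using (map′; _×-dec_; _⊎-dec_; _→-dec_; ¬?)
open import Relation.Binary.PropositionalEquality using (_≡_; _≢_; _≗_; refl; sym; trans; cong; subst; subst₂)

least-witness : {P : Pred ℕ 0ℓ} → Decidable P → ∀ b → P b → ∃ λ k → P k × (∀ m → P m → k ≤ m)
least-witness P? b Pb with P? 0
... | yes P0 = 0 , P0 , λ _ _ → z≤n
least-witness P? zero    Pb | no ¬P0 = contradiction Pb ¬P0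
least-witness P? (suc b) Pb | no ¬P0 with least-witness (P? ∘ suc) b Pb
... | k , Pk , least = suc k , Pk , λ { zero P0 → contradiction P0 ¬P0 ; (suc m) Pm → s≤s (least m Pm) }

Exhaustible : Set → Set₁
Exhaustible A = ∀ {P : Pred A 0ℓ} → Decidable P → Dec (∃ P)

BoundedList : Set → ℕ → Set
BoundedList A m = Σ (List A) λ xs → length xs ≤ m

module _ {A : Set} (search : Exhaustible A) where

  exhaustible-× : {B : Set} → Exhaustible B → Exhaustible (A × B)
  exhaustible-× searchB P? =
    map′ (λ (a , b , p) → (a , b) , p) (λ ((a , b) , p) → a , b , p)
         (search λ a → searchB λ b → P? (a , b))

  exhaustible-Vec : ∀ k → Exhaustible (Vec A k)
  exhaustible-Vec zero    P? = map′ ([] ,_) (λ { ([] , p) → p }) (P? [])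
  exhaustible-Vec (suc k) P? =
    map′ (λ (x , xs , p) → x ∷ xs , p) (λ { (x ∷ xs , p) → x , xs , p })
         (search λ x → exhaustible-Vec k λ xs → P? (x ∷ xs))

  -- Without function extensionality only ≗-invariant predicates on Fin k → A can be searched.
  exhaustible-→ : ∀ k {P : Pred (Fin k → A) 0ℓ} → (∀ {f g} → f ≗ g → P f → P g) → Decidable P → Dec (∃ P)
  exhaustible-→ k resp P? =
    map′ (λ (xs , p) → lookupᵛ xs , p) (λ (f , p) → tabulate f , resp (sym ∘ lookup∘tabulate f) p)
         (exhaustible-Vec k (P? ∘ lookupᵛ))

  exhaustible-BoundedList : ∀ m → Exhaustible (BoundedList A m)
  exhaustible-BoundedList zero    P? = map′ (_ ,_) (λ { (([] , z≤n) , p) → p }) (P? ([] , z≤n))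
  exhaustible-BoundedList (suc m) P? =
    map′ (λ { (inj₁ p) → _ , p ; (inj₂ (x , (xs , l) , p)) → (x ∷ xs , s≤s l) , p })
         (λ { (([] , z≤n) , p) → inj₁ p ; ((x ∷ xs , s≤s l) , p) → inj₂ (x , (xs , l) , p) })
         (P? ([] , z≤n) ⊎-dec search λ x → exhaustible-BoundedList m λ (xs , l) → P? (x ∷ xs , s≤s l))

module _ {A : Set} where

  -- last element of x ∷ xs; unlike List⁺'s last (defined via a snoc view) it computes on x ∷ y ∷ ys
  lastFrom : A → List A → A
  lastFrom x []       = x
  lastFrom _ (y ∷ ys) = lastFrom y ys

  lastFrom-++ : ∀ x ys zs → lastFrom x (ys ++ zs) ≡ lastFrom (lastFrom x ys) zs
  lastFrom-++ x []       zs = refl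
  lastFrom-++ x (y ∷ ys) zs = lastFrom-++ y ys zs

  last≡lastFrom : ∀ x xs → last (x ∷⁺ xs) ≡ lastFrom x xs
  last≡lastFrom x xs with initLast xs
  ... | []        = refl
  ... | ys ∷ʳ′ y = sym (lastFrom-++ x ys [ y ])

  ∈-∷-split : ∀ {v} x xs → v ∈ x ∷ xs → ∃₂ λ ys zs → xs ≡ ys ++ zs × lastFrom x ys ≡ v
  ∈-∷-split x xs (here refl) = [] , xs , refl , refl
  ∈-∷-split {v} x xs (there v∈xs) with ∈-∃++ v∈xs
  ... | ys , zs , refl = ys ++ [ v ] , zs , sym (++-assoc ys [ v ] zs) , lastFrom-++ x ys [ v ]

  length≡1⇒≡ : ∀ {xs : List A} {x y} → length xs ≡ 1 → x ∈ xs → y ∈ xs → x ≡ y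
  length≡1⇒≡ {_ ∷ []} _ (here refl) (here refl) = refl

  lookup-injective : ∀ {xs : List A} → Unique xs → ∀ {i j} → lookup xs i ≡ lookup xs j → i ≡ j
  lookup-injective {_ ∷ _}  (_ ∷ _)    {zero}  {zero}  _  = refl
  lookup-injective {_ ∷ xs} (x∉ ∷ _)   {zero}  {suc j} eq = contradiction eq (All.lookup x∉ (∈-lookup j))
  lookup-injective {_ ∷ xs} (x∉ ∷ _)   {suc i} {zero}  eq = contradiction (sym eq) (All.lookup x∉ (∈-lookup i))
  lookup-injective {_ ∷ _}  (_ ∷ uniq) {suc i} {suc j} eq = cong suc (lookup-injective uniq eq)

  module _ {R : Rel A 0ℓ} where

    AllPairs-++⁻ˡ : ∀ xs {ys} → AllPairs R (xs ++ ys) → AllPairs R xs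
    AllPairs-++⁻ˡ []       _          = []
    AllPairs-++⁻ˡ (x ∷ xs) (Rx ∷ Rxs) = Allₚ.++⁻ˡ xs Rx ∷ AllPairs-++⁻ˡ xs Rxs

    AllPairs-++⁻ʳ : ∀ xs {ys} → AllPairs R (xs ++ ys) → AllPairs R ys
    AllPairs-++⁻ʳ []       Rys       = Rys
    AllPairs-++⁻ʳ (x ∷ xs) (_ ∷ Rxs) = AllPairs-++⁻ʳ xs Rxs

    AllPairs-++⁻-across : ∀ xs {ys x y} → AllPairs R (xs ++ ys) → x ∈ xs → y ∈ ys → R x y
    AllPairs-++⁻-across (_ ∷ xs) (Rx ∷ _)  (here refl) y∈ys = All.lookup (Allₚ.++⁻ʳ xs Rx) y∈ys
    AllPairs-++⁻-across (_ ∷ xs) (_ ∷ Rxs) (there x∈xs) y∈ys = AllPairs-++⁻-across xs Rxs x∈xs y∈ys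

    Linked-++⁻ˡ : ∀ x ys {zs} → Linked R (x ∷ ys ++ zs) → Linked R (x ∷ ys)
    Linked-++⁻ˡ x []       _           = [-]
    Linked-++⁻ˡ x (y ∷ ys) (Rxy ∷ Rys) = Rxy ∷ Linked-++⁻ˡ y ys Rys

    Linked-++⁻ʳ : ∀ x ys {zs} → Linked R (x ∷ ys ++ zs) → Linked R (lastFrom x ys ∷ zs)
    Linked-++⁻ʳ x []       Rzs       = Rzs
    Linked-++⁻ʳ x (y ∷ ys) (_ ∷ Rys) = Linked-++⁻ʳ y ys Rys

    Linked-∷ʳ⁺ : ∀ x ys {z} → Linked R (x ∷ ys) → R (lastFrom x ys) z → Linked R (x ∷ ys ++ [ z ])
    Linked-∷ʳ⁺ x []       _           Rxz = Rxz ∷ [-]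
    Linked-∷ʳ⁺ x (y ∷ ys) (Rxy ∷ Rys) Rz  = Rxy ∷ Linked-∷ʳ⁺ y ys Rys Rz

module _ (G : Graph) where
  open Graph G using (n; adj; irrefl) renaming (sym to adj-sym)
  open import Data.List.Membership.DecPropositional (_≟ᶠ_ {n}) using (_∈?_)

  private
    V : Set
    V = Vertex G

  Adj-sym : ∀ {x y} → Adj G x y → Adj G y x
  Adj-sym {x} {y} x~y = trans (adj-sym y x) x~y

  Adj-irrefl : ∀ {x} → ¬ Adj G x x
  Adj-irrefl {x} x~x with trans (sym x~x) (irrefl x)
  ... | ()

  adj? : ∀ x y → Dec (Adj G x y)
  adj? x y = adj x y ≟ᵇ true

  pendant-neighbour : ∀ {u v w} → degree G u ≡ 1 → Adj G u v → Adj G u w → w ≡ v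
  pendant-neighbour {u} {v} {w} deg u~v u~w =
    length≡1⇒≡ deg (neighbour u~w) (neighbour u~v)
    where
    neighbour : ∀ {x} → Adj G u x → x ∈ filterᵇ (adj u) (allFin n)
    neighbour {x} u~x = ∈-filter⁺ _ (∈-allFin x) (subst T (sym u~x) _)

  _++ʷ_ : ∀ {a b c m k} → Walk G a b m → Walk G b c k → Walk G a c (m + k)
  nil        ++ʷ w′ = w′
  cons a~b w ++ʷ w′ = cons a~b (w ++ʷ w′)

  walkAlong : ∀ x {xs} → Linked (Adj G) (x ∷ xs) → Walk G x (lastFrom x xs) (length xs)
  walkAlong x [-]           = nil
  walkAlong x (x~y ∷ chain) = cons x~y (walkAlong _ chain)

  unsnocWalk : ∀ {a c k} → Walk G a c (suc k) → ∃ λ b → Walk G a b k × Adj G b c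
  unsnocWalk (cons a~c nil)            = _ , nil , a~c
  unsnocWalk (cons a~b w@(cons _ _)) with unsnocWalk w
  ... | b , w′ , b~c = b , cons a~b w′ , b~c

  walk? : ∀ a b k → Dec (Walk G a b k)
  walk? a b zero with a ≟ᶠ b
  ... | yes refl = yes nil
  ... | no a≢b   = no λ { nil → a≢b refl }
  walk? a b (suc k) =
    map′ (λ (c , a~c , w) → cons a~c w) (λ { (cons a~c w) → _ , a~c , w })
         (any? λ c → adj? a c ×-dec walk? c b k)

  DistAtLeast : V → V → ℕ → Set
  DistAtLeast a b d = ∀ k → Walk G a b k → d ≤ k

  distAtLeast? : ∀ a b d → Dec (DistAtLeast a b d)
  distAtLeast? a b d = map′ noShorter (λ d≤ i w → <⇒≱ (toℕ<n i) (d≤ _ w)) (all? λ i → ¬? (walk? a b (toℕ i)))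
    where
    noShorter : (∀ (i : Fin d) → ¬ Walk G a b (toℕ i)) → DistAtLeast a b d
    noShorter none k w = ≮⇒≥ λ k<d → none (fromℕ< k<d) (subst (Walk G a b) (sym (toℕ-fromℕ< k<d)) w)

  DistAtLeast-++ˡ : ∀ {a b c m k} → Walk G b c k → DistAtLeast a c (m + k) → DistAtLeast a b m
  DistAtLeast-++ˡ {k = k} w d≤ m′ w′ = +-cancelʳ-≤ k _ m′ (d≤ (m′ + k) (w′ ++ʷ w))

  DistAtLeast-++ʳ : ∀ {a b c m k} → Walk G a b m → DistAtLeast a c (m + k) → DistAtLeast b c k
  DistAtLeast-++ʳ {m = m} w d≤ k′ w′ = +-cancelˡ-≤ m _ k′ (d≤ (m + k′) (w ++ʷ w′))

  DistAtLeast-pendant : ∀ {a u v d} → (∀ {w} → Adj G u w → w ≡ v) → u ≢ a →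
                        DistAtLeast a v d → DistAtLeast a u (suc d)
  DistAtLeast-pendant N[u]⊆v u≢a d≤ zero    nil = contradiction refl u≢a
  DistAtLeast-pendant N[u]⊆v u≢a d≤ (suc k) w with unsnocWalk w
  ... | b , w′ , b~u = s≤s (d≤ k (subst (λ c → Walk G _ c k) (N[u]⊆v (Adj-sym b~u)) w′))

  IsGeodesic : V → List V → Set
  IsGeodesic x xs = DistAtLeast x (lastFrom x xs) (length xs)

  isometric⇒geodesic : ∀ x xs → DistAtLeast x (last (x ∷⁺ xs)) (length xs) → IsGeodesic x xs
  isometric⇒geodesic x xs = subst (λ y → DistAtLeast x y (length xs)) (last≡lastFrom x xs)

  geodesic⇒isometric : ∀ x xs → IsGeodesic x xs → DistAtLeast x (last (x ∷⁺ xs)) (length xs)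
  geodesic⇒isometric x xs = subst (λ y → DistAtLeast x y (length xs)) (sym (last≡lastFrom x xs))

  geodesic-++ˡ : ∀ x ys {zs} → Linked (Adj G) (x ∷ ys ++ zs) → IsGeodesic x (ys ++ zs) → IsGeodesic x ys
  geodesic-++ˡ x ys {zs} chain geo =
    DistAtLeast-++ˡ (walkAlong _ (Linked-++⁻ʳ x ys chain))
                    (subst₂ (DistAtLeast x) (lastFrom-++ x ys zs) (length-++ ys) geo)

  geodesic-++ʳ : ∀ x ys {zs} → Linked (Adj G) (x ∷ ys ++ zs) → IsGeodesic x (ys ++ zs) → IsGeodesic (lastFrom x ys) zs
  geodesic-++ʳ x ys {zs} chain geo =
    DistAtLeast-++ʳ (walkAlong x (Linked-++⁻ˡ x ys chain))
                    (subst₂ (DistAtLeast x) (lastFrom-++ x ys zs) (length-++ ys) geo)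

  geodesic-∷ʳ-pendant : ∀ x ys {u} → (∀ {w} → Adj G u w → w ≡ lastFrom x ys) → u ≢ x →
                        IsGeodesic x ys → IsGeodesic x (ys ++ [ u ])
  geodesic-∷ʳ-pendant x ys {u} N[u]⊆end u≢x geo =
    subst₂ (DistAtLeast x) (sym (lastFrom-++ x ys [ u ])) (sym (trans (length-++ ys) (+-comm _ 1)))
           (DistAtLeast-pendant N[u]⊆end u≢x geo)

  pendant-endpoint : ∀ {u v} → (∀ {w} → Adj G u w → w ≡ v) →
                     ∀ x xs → Linked (Adj G) (x ∷ xs) → Unique (x ∷ xs) → u ∈ x ∷ xs → u ≡ x ⊎ u ≡ lastFrom x xs
  pendant-endpoint N[u]⊆v x xs chain uniq (here u≡x) = inj₁ u≡x
  pendant-endpoint N[u]⊆v x (y ∷ ys) (x~y ∷ chain) (_ ∷ uniq) (there u∈)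
    with pendant-endpoint N[u]⊆v y ys chain uniq u∈
  ... | inj₂ u≡end = inj₂ u≡end
  pendant-endpoint N[u]⊆v x (y ∷ [])     _             _                    (there u∈) | inj₁ u≡y = inj₂ u≡y
  -- an interior u has two distinct neighbours on the path, but both would equal v
  pendant-endpoint N[u]⊆v x (y ∷ z ∷ zs) (x~y ∷ y~z ∷ _) ((_ ∷ x≢z ∷ _) ∷ _) (there u∈) | inj₁ refl =
    contradiction (trans (N[u]⊆v (Adj-sym x~y)) (sym (N[u]⊆v y~z))) x≢z

  module Replace {k} (P : IPPartition G k) {i j : Fin k} (i≢j : i ≢ j) (X Y : Path G)
                 (isoX : IsIsometric G X) (isoY : IsIsometric G Y)
                 (same : ∀ {x} → (OnPath G x X ⊎ OnPath G x Y) ⇔ (OnPath G x (path P i) ⊎ OnPath G x (path P j)))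
                 (X∩Y : ∀ {x} → OnPath G x X → ¬ OnPath G x Y) where

    replaced : Fin k → Path G
    replaced m with m ≟ᶠ i | m ≟ᶠ j
    ... | yes _ | _     = X
    ... | no _  | yes _ = Y
    ... | no _  | no _  = path P m

    data Slot (m : Fin k) : Path G → Set where
      at-i  : m ≡ i → Slot m X
      at-j  : m ≡ j → Slot m Y
      other : m ≢ i → m ≢ j → Slot m (path P m)

    slot : ∀ m → Slot m (replaced m)
    slot m with m ≟ᶠ i | m ≟ᶠ j
    ... | yes m≡i | _       = at-i m≡i
    ... | no _    | yes m≡j = at-j m≡j
    ... | no m≢i  | no m≢j  = other m≢i m≢j

    replaced-i : replaced i ≡ X
    replaced-i with replaced i | slot i
    ... | _ | at-i _     = refl
    ... | _ | at-j i≡j   = contradiction i≡j i≢j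
    ... | _ | other i≢i _ = contradiction refl i≢i

    replaced-j : replaced j ≡ Y
    replaced-j with replaced j | slot j
    ... | _ | at-i j≡i    = contradiction (sym j≡i) i≢j
    ... | _ | at-j _      = refl
    ... | _ | other _ j≢j = contradiction refl j≢j

    replaced-other : ∀ {m} → m ≢ i → m ≢ j → replaced m ≡ path P m
    replaced-other {m} m≢i m≢j with replaced m | slot m
    ... | _ | at-i m≡i  = contradiction m≡i m≢i
    ... | _ | at-j m≡j  = contradiction m≡j m≢j
    ... | _ | other _ _ = refl

    isometric-replaced : ∀ m → IsIsometric G (replaced m)
    isometric-replaced m with replaced m | slot m
    ... | _ | at-i _    = isoX
    ... | _ | at-j _    = isoY
    ... | _ | other _ _ = isometric P m

    on-X-or-Y : ∀ {x} → OnPath G x X ⊎ OnPath G x Y → ∃ λ m → OnPath G x (replaced m)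
    on-X-or-Y (inj₁ x∈X) = i , subst (OnPath G _) (sym replaced-i) x∈X
    on-X-or-Y (inj₂ x∈Y) = j , subst (OnPath G _) (sym replaced-j) x∈Y

    covers-replaced : ∀ x → ∃ λ m → OnPath G x (replaced m)
    covers-replaced x with covers P x
    ... | a , x∈ with a ≟ᶠ i | a ≟ᶠ j
    ...   | yes refl | _        = on-X-or-Y (Equivalence.from same (inj₁ x∈))
    ...   | no _     | yes refl = on-X-or-Y (Equivalence.from same (inj₂ x∈))
    ...   | no a≢i   | no a≢j   = a , subst (OnPath G x) (sym (replaced-other a≢i a≢j)) x∈

    untouched : ∀ {m x} → m ≢ i → m ≢ j → OnPath G x (path P m) → ¬ (OnPath G x X ⊎ OnPath G x Y)
    untouched m≢i m≢j x∈ x∈XY with Equivalence.to same x∈XY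
    ... | inj₁ x∈Pi = m≢i (disjoint P _ _ _ x∈ x∈Pi)
    ... | inj₂ x∈Pj = m≢j (disjoint P _ _ _ x∈ x∈Pj)

    disjoint-slots : ∀ {a b p q x} → Slot a p → Slot b q → OnPath G x p → OnPath G x q → a ≡ b
    disjoint-slots (at-i refl)   (at-i refl)   _  _  = refl
    disjoint-slots (at-i _)      (at-j _)      xX xY = contradiction xY (X∩Y xX)
    disjoint-slots (at-i _)      (other b≢i b≢j) xX x∈ = contradiction (inj₁ xX) (untouched b≢i b≢j x∈)
    disjoint-slots (at-j _)      (at-i _)      xY xX = contradiction xY (X∩Y xX)
    disjoint-slots (at-j refl)   (at-j refl)   _  _  = refl
    disjoint-slots (at-j _)      (other b≢i b≢j) xY x∈ = contradiction (inj₂ xY) (untouched b≢i b≢j x∈)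
    disjoint-slots (other a≢i a≢j) (at-i _)    x∈ xX = contradiction (inj₁ xX) (untouched a≢i a≢j x∈)
    disjoint-slots (other a≢i a≢j) (at-j _)    x∈ xY = contradiction (inj₂ xY) (untouched a≢i a≢j x∈)
    disjoint-slots (other _ _)   (other _ _)   x∈a x∈b = disjoint P _ _ _ x∈a x∈b

    partition : IPPartition G k
    partition = record
      { path      = replaced
      ; isometric = isometric-replaced
      ; covers    = covers-replaced
      ; disjoint  = λ x a b → disjoint-slots (slot a) (slot b)
      }

  module Merge {k} (P : IPPartition G (suc k)) {i j : Fin (suc k)} (j≢i : j ≢ i) (Z : Path G)
               (isoZ : IsIsometric G Z)
               (same : ∀ {x} → OnPath G x Z ⇔ (OnPath G x (path P i) ⊎ OnPath G x (path P j))) where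

    merged : Fin k → Path G
    merged m with punchIn j m ≟ᶠ i
    ... | yes _ = Z
    ... | no _  = path P (punchIn j m)

    data Slot (m : Fin k) : Path G → Set where
      at-i  : punchIn j m ≡ i → Slot m Z
      other : punchIn j m ≢ i → Slot m (path P (punchIn j m))

    slot : ∀ m → Slot m (merged m)
    slot m with punchIn j m ≟ᶠ i
    ... | yes m↦i = at-i m↦i
    ... | no m↦̸i  = other m↦̸i

    onPath-merged : ∀ {m x} → punchIn j m ≡ i → OnPath G x Z → OnPath G x (merged m)
    onPath-merged {m} m↦i x∈Z with merged m | slot m
    ... | _ | at-i _     = x∈Z
    ... | _ | other m↦̸i = contradiction m↦i m↦̸i

    onPath-other : ∀ {m x} → punchIn j m ≢ i → OnPath G x (path P (punchIn j m)) → OnPath G x (merged m)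
    onPath-other {m} m↦̸i x∈ with merged m | slot m
    ... | _ | at-i m↦i  = contradiction m↦i m↦̸i
    ... | _ | other _   = x∈

    isometric-merged : ∀ m → IsIsometric G (merged m)
    isometric-merged m with merged m | slot m
    ... | _ | at-i _  = isoZ
    ... | _ | other _ = isometric P (punchIn j m)

    covers-merged : ∀ x → ∃ λ m → OnPath G x (merged m)
    covers-merged x with covers P x
    ... | a , x∈ with a ≟ᶠ i | a ≟ᶠ j
    ...   | yes refl | _        = punchOut j≢i , onPath-merged (punchIn-punchOut j≢i) (Equivalence.from same (inj₁ x∈))
    ...   | no _     | yes refl = punchOut j≢i , onPath-merged (punchIn-punchOut j≢i) (Equivalence.from same (inj₂ x∈))
    ...   | no a≢i   | no a≢j   =
      punchOut j≢a , onPath-other (λ eq → a≢i (trans (sym (punchIn-punchOut j≢a)) eq))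
                                  (subst (OnPath G x ∘ path P) (sym (punchIn-punchOut j≢a)) x∈)
      where
      j≢a : j ≢ a
      j≢a j≡a = a≢j (sym j≡a)

    untouched : ∀ {m x} → punchIn j m ≢ i → OnPath G x (path P (punchIn j m)) → ¬ OnPath G x Z
    untouched {m} m↦̸i x∈ x∈Z with Equivalence.to same x∈Z
    ... | inj₁ x∈Pi = m↦̸i (disjoint P _ _ _ x∈ x∈Pi)
    ... | inj₂ x∈Pj = punchInᵢ≢i j m (disjoint P _ _ _ x∈ x∈Pj)

    disjoint-slots : ∀ {a b p q x} → Slot a p → Slot b q → OnPath G x p → OnPath G x q → a ≡ b
    disjoint-slots {a} {b} (at-i a↦i)  (at-i b↦i)  _   _   = punchIn-injective j a b (trans a↦i (sym b↦i))
    disjoint-slots         (at-i _)    (other b↦̸i) x∈Z x∈  = contradiction x∈Z (untouched b↦̸i x∈)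
    disjoint-slots         (other a↦̸i) (at-i _)    x∈  x∈Z = contradiction x∈Z (untouched a↦̸i x∈)
    disjoint-slots {a} {b} (other _)   (other _)   x∈a x∈b = punchIn-injective j a b (disjoint P _ _ _ x∈a x∈b)

    partition : IPPartition G k
    partition = record
      { path      = merged
      ; isometric = isometric-merged
      ; covers    = covers-merged
      ; disjoint  = λ x a b → disjoint-slots (slot a) (slot b)
      }

  Unique⇒length≤ : ∀ {xs : List V} → Unique xs → length xs ≤ n
  Unique⇒length≤ {xs} uniq = injective⇒≤ {f = lookup xs} (lookup-injective uniq)

  -- Path G contains proofs, which cannot be enumerated; the search runs over vertex lists instead.
  PathCode : Set
  PathCode = V × BoundedList V n

  vertsOf : PathCode → List V
  vertsOf (x , xs , _) = x ∷ xs

  IsPathCode : PathCode → Set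
  IsPathCode (x , xs , _) = Linked (Adj G) (x ∷ xs) × Unique (x ∷ xs) × DistAtLeast x (last (x ∷⁺ xs)) (length xs)

  IsIPCode : ∀ {k} → (Fin k → PathCode) → Set
  IsIPCode c = (∀ i → IsPathCode (c i))
             × (∀ x → ∃ λ i → x ∈ vertsOf (c i))
             × (∀ x i j → x ∈ vertsOf (c i) → x ∈ vertsOf (c j) → i ≡ j)

  isIPCode? : ∀ {k} → Decidable (IsIPCode {k})
  isIPCode? c =
    all? (λ i → isPathCode? (c i))
    ×-dec all? (λ x → any? λ i → x ∈? vertsOf (c i))
    ×-dec all? λ x → all? λ i → all? λ j → (x ∈? vertsOf (c i)) →-dec (x ∈? vertsOf (c j)) →-dec (i ≟ᶠ j)
    where
    isPathCode? : Decidable IsPathCode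
    isPathCode? (x , xs , _) =
      linked? adj? (x ∷ xs) ×-dec allPairs? (λ y z → ¬? (y ≟ᶠ z)) (x ∷ xs) ×-dec distAtLeast? _ _ _

  IsIPCode-resp : ∀ {k} {c d : Fin k → PathCode} → c ≗ d → IsIPCode c → IsIPCode d
  IsIPCode-resp c≗d (paths , cov , disj) =
    (λ i → subst IsPathCode (c≗d i) (paths i)) ,
    (λ x → let (i , x∈) = cov x in i , subst (λ p → x ∈ vertsOf p) (c≗d i) x∈) ,
    (λ x i j x∈i x∈j → disj x i j (subst (λ p → x ∈ vertsOf p) (sym (c≗d i)) x∈i)
                                  (subst (λ p → x ∈ vertsOf p) (sym (c≗d j)) x∈j))

  decode : ∀ {k} → Σ (Fin k → PathCode) IsIPCode → IPPartition G k
  decode (c , paths , cov , disj) = record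
    { path      = λ i → toPath (c i) (paths i)
    ; isometric = λ i → proj₂ (proj₂ (paths i))
    ; covers    = cov
    ; disjoint  = disj
    }
    where
    toPath : ∀ p → IsPathCode p → Path G
    toPath (x , xs , _) (chain , uniq , _) = record { verts = x ∷⁺ xs ; linked = chain ; distinct = uniq }

  encode : ∀ {k} → IPPartition G k → Σ (Fin k → PathCode) IsIPCode
  encode P = code , (λ i → linked (path P i) , distinct (path P i) , isometric P i) , covers P , disjoint P
    where
    code : Fin _ → PathCode
    code i = start G (path P i) , tail (verts (path P i)) , ≤-trans (n≤1+n _) (Unique⇒length≤ (distinct (path P i)))

  ipPartition? : ∀ k → Dec (IPPartition G k)
  ipPartition? k = map′ decode encode
    (exhaustible-→ (exhaustible-× any? (exhaustible-BoundedList any? n)) k IsIPCode-resp isIPCode?)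

  singletons : IPPartition G n
  singletons = record
    { path      = λ x → record { verts = x ∷⁺ [] ; linked = [-] ; distinct = [] ∷ [] }
    ; isometric = λ _ _ _ → z≤n
    ; covers    = λ x → x , here refl
    ; disjoint  = λ { x i j (here refl) (here refl) → refl }
    }

  minimum-IPPartition : ∃ λ k → IPPartition G k × IsMinimumIP G k
  minimum-IPPartition = least-witness ipPartition? n singletons

  1≰pathLength⇒≡ : ∀ p → 1 ≰ pathLength G p → ∀ {x y} → OnPath G x p → OnPath G y p → x ≡ y
  1≰pathLength⇒≡ record { verts = _ ∷⁺ [] }      _     (here refl) (here refl) = refl
  1≰pathLength⇒≡ record { verts = _ ∷⁺ (_ ∷ _) } short = contradiction (s≤s z≤n) short

  module _ {u v : V} (v~u : Adj G v u) (N[u]≡v : ∀ {w} → Adj G u w → w ≡ v) where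

    EndsAtU : Path G → Set
    EndsAtU p = 1 ≤ pathLength G p × (u ≡ start G p ⊎ u ≡ end G p)

    pendant-endsAtU : ∀ p → OnPath G u p → 1 ≤ pathLength G p → EndsAtU p
    pendant-endsAtU p u∈p long =
      long , map₂ (λ u≡end → trans u≡end (sym (last≡lastFrom (start G p) (tail (verts p)))))
                  (pendant-endpoint N[u]≡v _ _ (linked p) (distinct p) u∈p)

    attach-pendant : ∀ x xs → Linked (Adj G) (x ∷ xs) → Unique (x ∷ xs) → IsGeodesic x xs →
                     lastFrom x xs ≡ v → u ∉ x ∷ xs →
                     Σ (Path G) λ X → IsIsometric G X × EndsAtU X × (∀ {y} → OnPath G y X ⇔ (y ∈ x ∷ xs ⊎ y ≡ u))
    attach-pendant x xs chain uniq geo end≡v u∉ = X , isoX , (long , inj₂ u≡end) , mk⇔ split-∈ join-∈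
      where
      X : Path G
      X = record
        { verts    = x ∷⁺ xs ++ [ u ]
        ; linked   = Linked-∷ʳ⁺ x xs chain (subst (λ y → Adj G y u) (sym end≡v) v~u)
        ; distinct = Unique.++⁺ uniq ([] ∷ []) λ { (u∈ , here refl) → u∉ u∈ }
        }

      isoX : IsIsometric G X
      isoX = geodesic⇒isometric x (xs ++ [ u ])
        (geodesic-∷ʳ-pendant x xs (λ u~w → trans (N[u]≡v u~w) (sym end≡v)) (u∉ ∘ here) geo)

      long : 1 ≤ length (xs ++ [ u ])
      long = subst (1 ≤_) (sym (length-++ xs)) (m≤n+m 1 (length xs))

      u≡end : u ≡ end G X
      u≡end = sym (trans (last≡lastFrom x (xs ++ [ u ])) (lastFrom-++ x xs [ u ]))

      split-∈ : ∀ {y} → y ∈ x ∷ xs ++ [ u ] → y ∈ x ∷ xs ⊎ y ≡ u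
      split-∈ y∈ with ∈-++⁻ (x ∷ xs) y∈
      ... | inj₁ y∈xs        = inj₁ y∈xs
      ... | inj₂ (here y≡u) = inj₂ y≡u

      join-∈ : ∀ {y} → y ∈ x ∷ xs ⊎ y ≡ u → y ∈ x ∷ xs ++ [ u ]
      join-∈ (inj₁ y∈xs) = ∈-++⁺ˡ y∈xs
      join-∈ (inj₂ refl) = ∈-++⁺ʳ (x ∷ xs) (here refl)

    -- X is R up to v followed by u, Y is the rest of R when it is nonempty.
    data PendantSplit (R : Path G) : Set where
      absorbed : (X : Path G) → IsIsometric G X → EndsAtU X →
                 (∀ {x} → OnPath G x X ⇔ (OnPath G x R ⊎ x ≡ u)) → PendantSplit R
      split    : (X Y : Path G) → IsIsometric G X → IsIsometric G Y → EndsAtU X →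
                 (∀ {x} → (OnPath G x X ⊎ OnPath G x Y) ⇔ (OnPath G x R ⊎ x ≡ u)) →
                 (∀ {x} → OnPath G x X → ¬ OnPath G x Y) → PendantSplit R

    pendant-split : (R : Path G) → IsIsometric G R → OnPath G v R → ¬ OnPath G u R → PendantSplit R
    pendant-split record { verts = h ∷⁺ t ; linked = chain ; distinct = uniq } iso v∈R u∉R
      with ∈-∷-split h t v∈R
    ... | as , bs , refl , end≡v
      with attach-pendant h as (Linked-++⁻ˡ h as chain) (AllPairs-++⁻ˡ (h ∷ as) uniq)
                          (geodesic-++ˡ h as chain (isometric⇒geodesic h (as ++ bs) iso)) end≡v (u∉R ∘ ∈-++⁺ˡ)
    pendant-split record { verts = h ∷⁺ _ } _ _ _ | as , [] , refl , _ | X , isoX , endsX , ∈X =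
      absorbed X isoX endsX (mk⇔ (λ x∈X → map₁ ∈-++⁺ˡ (Equivalence.to ∈X x∈X)) (Equivalence.from ∈X ∘ drop-[]))
      where
      drop-[] : ∀ {x} → x ∈ h ∷ as ++ [] ⊎ x ≡ u → x ∈ h ∷ as ⊎ x ≡ u
      drop-[] (inj₁ x∈) with ∈-++⁻ (h ∷ as) x∈
      ... | inj₁ x∈as = inj₁ x∈as
      drop-[] (inj₂ x≡u) = inj₂ x≡u
    pendant-split record { linked = chain ; distinct = uniq } iso _ u∉R | as , b ∷ bs , refl , _ | X , isoX , endsX , ∈X =
      split X Y isoX isoY endsX (mk⇔ to from) X∩Y
      where
      Y : Path G
      Y = record
        { verts    = b ∷⁺ bs
        ; linked   = Linked.tail (Linked-++⁻ʳ _ as chain)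
        ; distinct = AllPairs-++⁻ʳ (_ ∷ as) uniq
        }

      isoY : IsIsometric G Y
      isoY = geodesic⇒isometric b bs
        (geodesic-++ʳ _ [ b ] (Linked-++⁻ʳ _ as chain) (geodesic-++ʳ _ as chain (isometric⇒geodesic _ (as ++ b ∷ bs) iso)))

      to : ∀ {x} → OnPath G x X ⊎ OnPath G x Y → x ∈ _ ∷ as ++ b ∷ bs ⊎ x ≡ u
      to (inj₁ x∈X) = map₁ ∈-++⁺ˡ (Equivalence.to ∈X x∈X)
      to (inj₂ x∈Y) = inj₁ (∈-++⁺ʳ (_ ∷ as) x∈Y)

      from : ∀ {x} → x ∈ _ ∷ as ++ b ∷ bs ⊎ x ≡ u → OnPath G x X ⊎ OnPath G x Y
      from (inj₁ x∈R) with ∈-++⁻ (_ ∷ as) x∈R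
      ... | inj₁ x∈as = inj₁ (Equivalence.from ∈X (inj₁ x∈as))
      ... | inj₂ x∈Y  = inj₂ x∈Y
      from (inj₂ x≡u) = inj₁ (Equivalence.from ∈X (inj₂ x≡u))

      X∩Y : ∀ {x} → OnPath G x X → ¬ OnPath G x Y
      X∩Y x∈X x∈Y with Equivalence.to ∈X x∈X
      ... | inj₁ x∈as = AllPairs-++⁻-across (_ ∷ as) uniq x∈as x∈Y refl
      ... | inj₂ refl = u∉R (∈-++⁺ʳ (_ ∷ as) x∈Y)

    MinimumWithPendantPath : Set
    MinimumWithPendantPath =
      Σ ℕ λ k → Σ (IPPartition G k) λ P → IsMinimumIP G k × Σ (Fin k) λ i → EndsAtU (path P i)

    module _ {k} (P : IPPartition G (suc k)) (minimal : IsMinimumIP G (suc k))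
             {iu : Fin (suc k)} (only-u : ∀ {x} → OnPath G x (path P iu) ⇔ (x ≡ u)) where

      private
        iv : Fin (suc k)
        iv = proj₁ (covers P v)

        iv≢iu : iv ≢ iu
        iv≢iu iv≡iu = Adj-irrefl (subst (λ y → Adj G y u) (Equivalence.to only-u v∈) v~u)
          where
          v∈ : OnPath G v (path P iu)
          v∈ = subst (λ i → OnPath G v (path P i)) iv≡iu (proj₂ (covers P v))

        u∉R : ¬ OnPath G u (path P iv)
        u∉R u∈R = iv≢iu (disjoint P u iv iu u∈R (Equivalence.from only-u refl))

        R∪u : ∀ {x} → (OnPath G x (path P iv) ⊎ x ≡ u) ⇔ (OnPath G x (path P iv) ⊎ OnPath G x (path P iu))
        R∪u = ⇔-refl ⊎-⇔ ⇔-sym only-u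

      exchange : PendantSplit (path P iv) → MinimumWithPendantPath
      exchange (absorbed Z isoZ _ ∈Z) =
        contradiction (minimal k (Merge.partition P {iv} {iu} (iv≢iu ∘ sym) Z isoZ (⇔-trans ∈Z R∪u))) 1+n≰n
      exchange (split X Y isoX isoY endsX ∈XY X∩Y) =
        suc k , Swap.partition , minimal , iv , subst EndsAtU (sym Swap.replaced-i) endsX
        where module Swap = Replace P iv≢iu X Y isoX isoY (⇔-trans ∈XY R∪u) X∩Y

      exchange-at-singleton : MinimumWithPendantPath
      exchange-at-singleton = exchange (pendant-split (path P iv) (isometric P iv) (proj₂ (covers P v)) u∉R)

    minimum-with-pendant-path : (∃ λ k → IPPartition G k × IsMinimumIP G k) → MinimumWithPendantPath
    minimum-with-pendant-path (zero , P , _) = contradiction (proj₁ (covers P u)) ¬Fin0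
    minimum-with-pendant-path (suc k , P , minimal) with covers P u
    ... | iu , u∈ with 1 ≤? pathLength G (path P iu)
    ...   | yes long = suc k , P , minimal , iu , pendant-endsAtU (path P iu) u∈ long
    ...   | no short = exchange-at-singleton P minimal
                         (mk⇔ (λ x∈ → 1≰pathLength⇒≡ (path P iu) short x∈ u∈) λ { refl → u∈ })

mainTheorem6 : (G : Graph) (v u : Vertex G) →
    Adj G v u → degree G u ≡ 1 →
    (∀ w → Adj G v w → degree G w ≡ 1 → w ≡ u) →
    Σ ℕ λ k → Σ (IPPartition G k) λ P → IsMinimumIP G k ×
      (Σ (Fin k) λ i → (1 ≤ pathLength G (path P i)) ×
        ((u ≡ start G (path P i)) ⊎ (u ≡ end G (path P i))))
mainTheorem6 G v u v~u deg-u _ =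
  minimum-with-pendant-path G v~u (pendant-neighbour G deg-u (Adj-sym G v~u)) (minimum-IPPartition G)
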